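{- Let $f\in F(n)$ and suppose that $\mathcal{S}(f)$ contains a collection of $d\leq 2^{n-3}$ pairwise vertex-disjoint subgraphs, each isomorphic to $C_1$, $C_2$ or $2P_2$. Then there exists $h\in F(n)$ with $h\sim f$ such that $\mathcal{A}(h)$ has at least $d$ attractors, each of size at most $4$.
   Context: $F(n)$ is the set of all functions $\{0,1\}^n\to\{0,1\}^n$, written $f=(f_1,\dots,f_n)$. $\mathcal{S}(f)$ is the digraph on $\{0,1\}^n$ with an arc $x\to f(x)$ for every $x$. $C_\ell$ is the directed cycle of length $\ell$ ($C_1$ is a loop, i.e. a fixed point); $P_2$ is the directed path of length $2$ (on $3$ vertices), and $2P_2$ is the disjoint union of two copies of $P_2$. $e_i$ is the configuration with a $1$ exactly in component $i$; addition is componentwise mod $2$. $\mathcal{A}(h)$ is the digraph on $\{0,1\}^n$ with an arc $x\to x+e_i$ whenever $h_i(x)\neq x_i$. An attractor is an inclusion-minimal non-empty set of configurations with no arc leaving it. $h\sim f$ means $\mathcal{S}(h)$ and $\mathcal{S}(f)$ are isomorphic. -}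

module Defs where

open import Data.Nat using (ℕ; _≤_)
open import Data.Bool using (Bool; _xor_)
open import Data.Fin using (Fin; _≟_)
open import Data.Vec using (Vec; lookup; tabulate; zipWith)
open import Data.List using (List; []; _∷_; length)
open import Data.List.Membership.Propositional using (_∈_)
open import Data.Product using (Σ; ∃; _×_; _,_)
open import Relation.Nullary using (¬_)
open import Relation.Nullary.Decidable using (isYes)
open import Relation.Binary.PropositionalEquality using (_≡_; _≢_)
open import Function.Bundles using (_↔_; Inverse)
open import Level using (0ℓ)

Config : ℕ → Set
Config n = Vec Bool n

Fn : ℕ → Set
Fn n = Config n → Config n

_⊕_ : ∀ {n} → Config n → Config n → Config n
_⊕_ = zipWith _xor_

e : ∀ {n} → Fin n → Config n
e i = tabulate (λ j → isYes (i ≟ j))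

ArcS : ∀ {n} → Fn n → Config n → Config n → Set
ArcS f x y = f x ≡ y

ArcA : ∀ {n} → Fn n → Config n → Config n → Set
ArcA h x y = Σ (Fin _) λ i → (lookup (h x) i ≢ lookup x i) × (y ≡ x ⊕ e i)

_∼_ : ∀ {n} → Fn n → Fn n → Set
_∼_ {n} h f = Σ (Config n ↔ Config n) λ π →
  let open Inverse π renaming (to to p) in
  ∀ x y → (ArcS f x y → ArcS h (p x) (p y)) × (ArcS h (p x) (p y) → ArcS f x y)

data Gadget (n : ℕ) : Set where
  c1   : Config n → Gadget n
  c2   : Config n → Config n → Gadget n
  p2p2 : (a b c a' b' c' : Config n) → Gadget n

verts : ∀ {n} → Gadget n → List (Config n)
verts (c1 x) = x ∷ []
verts (c2 x y) = x ∷ y ∷ []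
verts (p2p2 a b c a' b' c') = a ∷ b ∷ c ∷ a' ∷ b' ∷ c' ∷ []

-- the gadget's arcs are arcs of S(f)
-- (vertex-distinctness is imposed globally by Unique on all vertices)
InS : ∀ {n} → Fn n → Gadget n → Set
InS f (c1 x) = ArcS f x x
InS f (c2 x y) = ArcS f x y × ArcS f y x
InS f (p2p2 a b c a' b' c') =
  ArcS f a b × ArcS f b c × ArcS f a' b' × ArcS f b' c'

Trap : ∀ {n} → Fn n → (Config n → Set) → Set
Trap h B = ∀ x y → B x → ArcA h x y → B y

IsAttractor : ∀ {n} → Fn n → List (Config n) → Set₁
IsAttractor {n} h A =
  (∃ λ x → x ∈ A) ×
  Trap h (_∈ A) ×
  (∀ (B : Config n → Set) → (∀ x → B x → x ∈ A) → (∃ λ x → B x) → Trap h B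
     → ∀ x → x ∈ A → B x)

SameSet : ∀ {n} → List (Config n) → List (Config n) → Set
SameSet A B = (∀ x → x ∈ A → x ∈ B) × (∀ x → x ∈ B → x ∈ A)

{-# OPTIONS --safe #-}
module Submission where

-- Write n = 3 + m. Since 8d ≤ 2ⁿ, the d gadgets get pairwise distinct labels w ∈ {0,1}ᵐ,
-- and a permutation π of {0,1}ⁿ moves the gadget labelled w into the subcube
-- {u ++ w | u ∈ {0,1}³}: a fixed point to 000, a 2-cycle to 000 ⇄ 100, and the paths
-- a → b → c, a′ → b′ → c′ to 100 → 000 → 110 and 011 → 010 → 001. Then h = π ∘ f ∘ π⁻¹ ∼ f
-- maps 000, 100, 010 and 011 into their subcube, so in A(h) these points can only flip one
-- of their first three bits. Hence {000}, {000, 100} and {000, 100, 010, 011} are strongly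
-- connected traps of A(h), i.e. attractors, and distinct labels keep them apart.

open import Defs
open import Data.Nat using (ℕ; zero; suc; _≤_; _*_; _^_; _+_; s≤s; z≤n)
open import Data.Nat.Properties using (≤-refl; ≤-trans; ≤-reflexive; *-cancelˡ-≤; m≤m*n; ^-distribˡ-+-*)
open import Data.Bool using (Bool; true; false; not)
import Data.Bool.Properties as Bool
open import Data.Fin as Fin using (Fin; zero; suc; #_; splitAt; _↑ˡ_; inject≤; remQuot)
open import Data.Fin.Properties using (splitAt⁻¹-↑ˡ; splitAt⁻¹-↑ʳ; inject≤-injective; *↔×; 2↔Bool)
open import Data.Vec using (Vec; []; _∷_; _++_; lookup; tabulate)
open import Data.Vec.Properties as Vec using (lookup-++ˡ; lookup-++ʳ; ++-injectiveˡ; ++-injectiveʳ; ∷-injectiveˡ; ∷-injectiveʳ; ≡-dec)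
open import Data.List as List using (List; []; _∷_; length; map; concat; concatMap; zip)
open import Data.List.Properties using (length-map; concat-map; map-tabulate; tabulate-lookup; tabulate-cong)
open import Data.List.Relation.Unary.All as All using (All; []; _∷_)
import Data.List.Relation.Unary.All.Properties as All
open import Data.List.Relation.Unary.AllPairs using (_∷_)
import Data.List.Relation.Unary.AllPairs.Properties as AllPairs
open import Data.List.Relation.Unary.Any using (here; there)
open import Data.List.Relation.Unary.Unique.Propositional using (Unique)
import Data.List.Relation.Unary.Unique.Propositional.Properties as Unique
open import Data.List.Relation.Unary.Unique.DecPropositional (≡-dec {n = 3} Bool._≟_) using (unique?)
open import Data.List.Relation.Binary.Disjoint.Propositional using (Disjoint)
open import Data.List.Membership.Propositional using (_∈_)
open import Data.List.Membership.Propositional.Properties using (∈-map⁺; ∈-map⁻; ∈-lookup)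
open import Data.Product as Product using (Σ; ∃; _×_; _,_; proj₁; proj₂)
open import Data.Product.Properties using (×-≡,≡→≡)
open import Data.Sum using (inj₁; inj₂)
open import Function using (_∘_; Injective)
open import Function.Bundles using (_↔_; Inverse; Injection; mk↔ₛ′)
open import Function.Construct.Identity using (↔-id)
open import Function.Construct.Composition using (_↔-∘_)
open import Function.Properties.Inverse using (Inverse⇒Injection)
open import Relation.Nullary using (¬_; Dec; yes; no; contradiction)
open import Relation.Nullary.Decidable using (isYes; from-yes)
open import Relation.Binary.Definitions using (DecidableEquality)
open import Relation.Binary.PropositionalEquality
open import Relation.Binary.Construct.Closure.ReflexiveTransitive using (Star; ε; _◅_; _◅◅_)

open Inverse using (to; from; strictlyInverseʳ)

to-injective : ∀ {a b} {A : Set a} {B : Set b} (π : A ↔ B) → Injective _≡_ _≡_ (to π)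
to-injective π = Injection.injective (Inverse⇒Injection π)

module _ {a} {A : Set a} (_≟_ : DecidableEquality A) where

  transpose : A → A → A → A
  transpose a b x with x ≟ a
  ... | yes _ = b
  ... | no _ with x ≟ b
  ...   | yes _ = a
  ...   | no _ = x

  transpose-matchˡ : ∀ a b → transpose a b a ≡ b
  transpose-matchˡ a b with a ≟ a
  ... | yes _ = refl
  ... | no a≢a = contradiction refl a≢a

  transpose-matchʳ : ∀ a b → transpose a b b ≡ a
  transpose-matchʳ a b with b ≟ a
  ... | yes b≡a = b≡a
  ... | no _ with b ≟ b
  ...   | yes _ = refl
  ...   | no b≢b = contradiction refl b≢b

  transpose-fixes : ∀ {a b x} → x ≢ a → x ≢ b → transpose a b x ≡ x
  transpose-fixes {a} {b} {x} x≢a x≢b with x ≟ a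
  ... | yes x≡a = contradiction x≡a x≢a
  ... | no _ with x ≟ b
  ...   | yes x≡b = contradiction x≡b x≢b
  ...   | no _ = refl

  transpose-involutive : ∀ a b x → transpose a b (transpose a b x) ≡ x
  transpose-involutive a b x = by-cases (x ≟ a) (x ≟ b)
    where
    by-cases : ∀ {x} → Dec (x ≡ a) → Dec (x ≡ b) → transpose a b (transpose a b x) ≡ x
    by-cases (yes refl) _ = trans (cong (transpose a b) (transpose-matchˡ a b)) (transpose-matchʳ a b)
    by-cases (no _) (yes refl) = trans (cong (transpose a b) (transpose-matchʳ a b)) (transpose-matchˡ a b)
    by-cases (no x≢a) (no x≢b) =
      trans (cong (transpose a b) (transpose-fixes x≢a x≢b)) (transpose-fixes x≢a x≢b)

  transposition : A → A → A ↔ A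
  transposition a b =
    mk↔ₛ′ (transpose a b) (transpose a b) (transpose-involutive a b) (transpose-involutive a b)

  matching⇒bijection : (ps : List (A × A)) → Unique (map proj₁ ps) → Unique (map proj₂ ps) →
                       Σ (A ↔ A) λ π → All (λ (x , y) → to π x ≡ y) ps
  matching⇒bijection [] _ _ = ↔-id A , []
  matching⇒bijection ((x , y) ∷ ps) (x∉ ∷ xs!) (y∉ ∷ ys!) =
    transposition y (to π x) ↔-∘ π ,
    transpose-matchʳ y (to π x) ∷ All.zipWith moved (All.zip (All.map⁻ x∉ , All.map⁻ y∉) , π-ps)
    where
    π : A ↔ A
    π = proj₁ (matching⇒bijection ps xs! ys!)
    π-ps : All (λ (x′ , y′) → to π x′ ≡ y′) ps
    π-ps = proj₂ (matching⇒bijection ps xs! ys!)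
    moved : ∀ {(x′ , y′) : A × A} → (x ≢ x′ × y ≢ y′) × to π x′ ≡ y′ →
            transpose y (to π x) (to π x′) ≡ y′
    moved ((x≢x′ , y≢y′) , refl) = transpose-fixes (y≢y′ ∘ sym) (x≢x′ ∘ sym ∘ to-injective π)

module _ {n} (π : Config n ↔ Config n) (f : Fn n) where

  conjugate : Fn n
  conjugate = to π ∘ f ∘ from π

  conjugate-maps : ∀ {x x′ y y′} → to π x ≡ x′ → f x ≡ y → to π y ≡ y′ → conjugate x′ ≡ y′
  conjugate-maps {x} refl refl refl = cong (to π ∘ f) (strictlyInverseʳ π x)

  conjugate-∼ : conjugate ∼ f
  conjugate-∼ = π , λ x y → (λ fx≡y → conjugate-maps refl fx≡y refl) , reflect
    where
    reflect : ∀ {x y} → conjugate (to π x) ≡ to π y → f x ≡ y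
    reflect {x} eq = to-injective π (trans (sym (conjugate-maps refl refl refl)) eq)

binary : ∀ m → Fin (2 ^ m) → Vec Bool m
binary zero    _ = []
binary (suc m) i = let b , j = remQuot {2} (2 ^ m) i in to 2↔Bool b ∷ binary m j

binary-injective : ∀ m → Injective _≡_ _≡_ (binary m)
binary-injective zero    {zero} {zero} _  = refl
binary-injective (suc m)               eq = to-injective (*↔× {2} {2 ^ m})
  (×-≡,≡→≡ (to-injective 2↔Bool (∷-injectiveˡ eq) , binary-injective m (∷-injectiveʳ eq)))

Step : ∀ {n} → Config n → Config n → Config n → Set
Step t x z = Σ (Fin _) λ i → (lookup t i ≢ lookup x i) × (z ≡ x ⊕ e i)

⊕-identityʳ : ∀ {n} (x : Config n) → x ⊕ tabulate (λ _ → false) ≡ x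
⊕-identityʳ []      = refl
⊕-identityʳ (b ∷ x) = cong₂ _∷_ (Bool.xor-identityʳ b) (⊕-identityʳ x)

⊕-e-zero : ∀ {n} b (x : Config n) → (b ∷ x) ⊕ e zero ≡ not b ∷ x
⊕-e-zero b x = cong₂ _∷_ (Bool.xor-comm b true) (⊕-identityʳ x)

⊕-e-suc : ∀ {n} b (x : Config n) i → (b ∷ x) ⊕ e (suc i) ≡ b ∷ (x ⊕ e i)
⊕-e-suc b x i = cong₂ _∷_ (Bool.xor-identityʳ b) (cong (x ⊕_) (Vec.tabulate-cong suc≟suc))
  where
  suc≟suc : ∀ j → isYes (suc i Fin.≟ suc j) ≡ isYes (i Fin.≟ j)
  suc≟suc j with i Fin.≟ j
  ... | yes _ = refl
  ... | no _  = refl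

++-⊕-e-↑ˡ : ∀ {k m} (u : Config k) (w : Config m) i → (u ++ w) ⊕ e (i ↑ˡ m) ≡ (u ⊕ e i) ++ w
++-⊕-e-↑ˡ (b ∷ u) w zero = begin
  (b ∷ u ++ w) ⊕ e zero     ≡⟨ ⊕-e-zero b (u ++ w) ⟩
  not b ∷ u ++ w            ≡⟨ cong (_++ w) (⊕-e-zero b u) ⟨
  ((b ∷ u) ⊕ e zero) ++ w   ∎
  where open ≡-Reasoning
++-⊕-e-↑ˡ {m = m} (b ∷ u) w (suc i) = begin
  (b ∷ u ++ w) ⊕ e (suc (i ↑ˡ m)) ≡⟨ ⊕-e-suc b (u ++ w) (i ↑ˡ m) ⟩
  b ∷ (u ++ w) ⊕ e (i ↑ˡ m)       ≡⟨ cong (b ∷_) (++-⊕-e-↑ˡ u w i) ⟩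
  b ∷ (u ⊕ e i) ++ w              ≡⟨ cong (_++ w) (⊕-e-suc b u i) ⟨
  ((b ∷ u) ⊕ e (suc i)) ++ w      ∎
  where open ≡-Reasoning

module _ {k m} {t u : Config k} {w : Config m} where

  step-++ : ∀ {z} → Step t u z → Step (t ++ w) (u ++ w) (z ++ w)
  step-++ (i , t≢u , refl) =
    i ↑ˡ m , subst₂ _≢_ (sym (lookup-++ˡ t w i)) (sym (lookup-++ˡ u w i)) t≢u , sym (++-⊕-e-↑ˡ u w i)

  step-++⁻ : ∀ {y} → Step (t ++ w) (u ++ w) y → ∃ λ z → Step t u z × y ≡ z ++ w
  step-++⁻ (i , t≢u , refl) with splitAt k i in split
  ... | inj₁ j with refl ← splitAt⁻¹-↑ˡ split =
    u ⊕ e j , (j , subst₂ _≢_ (lookup-++ˡ t w j) (lookup-++ˡ u w j) t≢u , refl) , ++-⊕-e-↑ˡ u w j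
  ... | inj₂ j with refl ← splitAt⁻¹-↑ʳ split =
    contradiction (trans (lookup-++ʳ t w j) (sym (lookup-++ʳ u w j))) t≢u

module _ {n} (h : Fn n) where

  Reach : Config n → Config n → Set
  Reach = Star (ArcA h)

  trap-closed : ∀ {B x y} → Trap h B → B x → Reach x y → B y
  trap-closed B-trap Bx ε         = Bx
  trap-closed B-trap Bx (arc ◅ p) = trap-closed B-trap (B-trap _ _ Bx arc) p

  record RootedTrap (A : List (Config n)) : Set where
    field
      root      : Config n
      root∈     : root ∈ A
      trap      : Trap h (_∈ A)
      connected : All (λ x → Reach x root × Reach root x) A

  rootedTrap⇒attractor : ∀ {A} → RootedTrap A → IsAttractor h A
  rootedTrap⇒attractor {A} R = (root , root∈) , trap , minimal
    where
    open RootedTrap R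
    minimal : ∀ B → (∀ x → B x → x ∈ A) → ∃ B → Trap h B → ∀ x → x ∈ A → B x
    minimal B B⊆A (y , By) B-trap x x∈A =
      trap-closed B-trap (trap-closed B-trap By (proj₁ (All.lookup connected (B⊆A y By))))
                  (proj₂ (All.lookup connected x∈A))

module _ {k m} {h : Fn (k + m)} {g : Fn k} {w : Config m} {A : List (Config k)}
         (agree : All (λ u → h (u ++ w) ≡ g u ++ w) A) where

  arc-++ : ∀ {u v} → u ∈ A → ArcA g u v → ArcA h (u ++ w) (v ++ w)
  arc-++ {u} {v} u∈A arc =
    subst (λ t → Step t (u ++ w) (v ++ w)) (sym (All.lookup agree u∈A)) (step-++ {t = g u} arc)

  arc-++⁻ : ∀ {u y} → u ∈ A → ArcA h (u ++ w) y → ∃ λ v → ArcA g u v × y ≡ v ++ w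
  arc-++⁻ {u} {y} u∈A arc =
    step-++⁻ {t = g u} (subst (λ t → Step t (u ++ w) y) (All.lookup agree u∈A) arc)

  rootedTrap-++ : RootedTrap g A → RootedTrap h (map (_++ w) A)
  rootedTrap-++ R = record
    { root      = root ++ w
    ; root∈     = ∈-map⁺ (_++ w) root∈
    ; trap      = trap-++
    ; connected = All.map⁺ (All.tabulate λ u∈A →
                    Product.map (reach-++ u∈A) (reach-++ root∈) (All.lookup connected u∈A))
    }
    where
    open RootedTrap R
    trap-++ : Trap h (_∈ map (_++ w) A)
    trap-++ x y x∈ arc with ∈-map⁻ (_++ w) x∈
    ... | u , u∈A , refl with arc-++⁻ u∈A arc
    ...   | v , arc′ , refl = ∈-map⁺ (_++ w) (trap u v u∈A arc′)
    reach-++ : ∀ {u v} → u ∈ A → Reach g u v → Reach h (u ++ w) (v ++ w)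
    reach-++ u∈A ε         = ε
    reach-++ u∈A (arc ◅ p) = arc-++ u∈A arc ◅ reach-++ (trap _ _ u∈A arc) p

data Shape : Set where
  C₁ C₂ 2P₂ : Shape

pattern O = false
pattern I = true
pattern ⟨_,_,_⟩ a b c = a ∷ b ∷ c ∷ []

-- Only the values on `attractor s` matter; elsewhere the local map is arbitrary.
dynamics : Shape → Fn 3
dynamics C₁  u             = u
dynamics C₂  u             = u ⊕ e zero
dynamics 2P₂ ⟨ O , O , O ⟩ = ⟨ I , I , O ⟩
dynamics 2P₂ ⟨ I , O , O ⟩ = ⟨ O , O , O ⟩
dynamics 2P₂ ⟨ O , I , O ⟩ = ⟨ O , O , I ⟩
dynamics 2P₂ ⟨ O , I , I ⟩ = ⟨ O , I , O ⟩
dynamics 2P₂ u             = u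

attractor : Shape → List (Config 3)
attractor C₁  = ⟨ O , O , O ⟩ ∷ []
attractor C₂  = ⟨ O , O , O ⟩ ∷ ⟨ I , O , O ⟩ ∷ []
attractor 2P₂ = ⟨ O , O , O ⟩ ∷ ⟨ I , O , O ⟩ ∷ ⟨ O , I , O ⟩ ∷ ⟨ O , I , I ⟩ ∷ []

attractor-length : ∀ s → length (attractor s) ≤ 4
attractor-length C₁  = s≤s z≤n
attractor-length C₂  = s≤s (s≤s z≤n)
attractor-length 2P₂ = ≤-refl

flip-reach : ∀ {n} (h : Fn n) {x} i → lookup (h x) i ≢ lookup x i → Reach h x (x ⊕ e i)
flip-reach h i h≢x = (i , h≢x , refl) ◅ ε

rootedTrap : ∀ s → RootedTrap (dynamics s) (attractor s)
rootedTrap C₁ = record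
  { root      = ⟨ O , O , O ⟩
  ; root∈     = here refl
  ; trap      = λ { _ _ _ (_ , h≢x , _) → contradiction refl h≢x }
  ; connected = (ε , ε) ∷ []
  }
rootedTrap C₂ = record
  { root      = ⟨ O , O , O ⟩
  ; root∈     = here refl
  ; trap      = trap
  ; connected = (ε , ε) ∷ (flip-reach g (# 0) (λ ()) , flip-reach g (# 0) (λ ())) ∷ []
  }
  where
  g : Fn 3
  g = dynamics C₂
  trap : Trap g (_∈ attractor C₂)
  trap _ _ (here refl)         (zero , _ , refl)          = there (here refl)
  trap _ _ (there (here refl)) (zero , _ , refl)          = here refl
  trap _ _ (here refl)         (suc zero , h≢x , _)       = contradiction refl h≢x
  trap _ _ (there (here refl)) (suc zero , h≢x , _)       = contradiction refl h≢x
  trap _ _ (here refl)         (suc (suc zero) , h≢x , _) = contradiction refl h≢x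
  trap _ _ (there (here refl)) (suc (suc zero) , h≢x , _) = contradiction refl h≢x
rootedTrap 2P₂ = record
  { root      = ⟨ O , O , O ⟩
  ; root∈     = here refl
  ; trap      = trap
  ; connected = (ε , ε)
              ∷ (flip-reach g (# 0) (λ ()) , flip-reach g (# 0) (λ ()))
              ∷ (flip-reach g (# 1) (λ ()) , flip-reach g (# 1) (λ ()))
              ∷ ( flip-reach g (# 2) (λ ()) ◅◅ flip-reach g (# 1) (λ ())
                , flip-reach g (# 1) (λ ()) ◅◅ flip-reach g (# 2) (λ ()))
              ∷ []
  }
  where
  g : Fn 3
  g = dynamics 2P₂
  trap : Trap g (_∈ attractor 2P₂)
  trap _ _ (here refl)                         (zero , _ , refl)           = there (here refl)
  trap _ _ (here refl)                         (suc zero , _ , refl)       = there (there (here refl))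
  trap _ _ (here refl)                         (suc (suc zero) , h≢x , _)  = contradiction refl h≢x
  trap _ _ (there (here refl))                 (zero , _ , refl)           = here refl
  trap _ _ (there (here refl))                 (suc zero , h≢x , _)        = contradiction refl h≢x
  trap _ _ (there (here refl))                 (suc (suc zero) , h≢x , _)  = contradiction refl h≢x
  trap _ _ (there (there (here refl)))         (zero , h≢x , _)            = contradiction refl h≢x
  trap _ _ (there (there (here refl)))         (suc zero , _ , refl)       = here refl
  trap _ _ (there (there (here refl)))         (suc (suc zero) , _ , refl) = there (there (there (here refl)))
  trap _ _ (there (there (there (here refl)))) (zero , h≢x , _)            = contradiction refl h≢x
  trap _ _ (there (there (there (here refl)))) (suc zero , h≢x , _)        = contradiction refl h≢x
  trap _ _ (there (there (there (here refl)))) (suc (suc zero) , _ , refl) = there (there (here refl))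

shape : ∀ {n} → Gadget n → Shape
shape (c1 _)             = C₁
shape (c2 _ _)           = C₂
shape (p2p2 _ _ _ _ _ _) = 2P₂

slots : Shape → List (Config 3)
slots C₁  = ⟨ O , O , O ⟩ ∷ []
slots C₂  = ⟨ O , O , O ⟩ ∷ ⟨ I , O , O ⟩ ∷ []
slots 2P₂ = ⟨ I , O , O ⟩ ∷ ⟨ O , O , O ⟩ ∷ ⟨ I , I , O ⟩
          ∷ ⟨ O , I , I ⟩ ∷ ⟨ O , I , O ⟩ ∷ ⟨ O , O , I ⟩ ∷ []

slots-unique : ∀ s → Unique (slots s)
slots-unique C₁  = from-yes (unique? (slots C₁))
slots-unique C₂  = from-yes (unique? (slots C₂))
slots-unique 2P₂ = from-yes (unique? (slots 2P₂))

placement : ∀ {m} → Config m → Gadget (3 + m) → List (Config (3 + m) × Config (3 + m))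
placement w G = zip (verts G) (map (_++ w) (slots (shape G)))

placement-sources : ∀ {m} (w : Config m) G → map proj₁ (placement w G) ≡ verts G
placement-sources w (c1 _)             = refl
placement-sources w (c2 _ _)           = refl
placement-sources w (p2p2 _ _ _ _ _ _) = refl

placement-targets : ∀ {m} (w : Config m) G →
                    map proj₂ (placement w G) ≡ map (_++ w) (slots (shape G))
placement-targets w (c1 _)             = refl
placement-targets w (c2 _ _)           = refl
placement-targets w (p2p2 _ _ _ _ _ _) = refl

module _ {m} (π : Config (3 + m) ↔ Config (3 + m)) (f : Fn (3 + m)) (w : Config m) where

  conjugate-agrees : ∀ G → InS f G → All (λ (x , y) → to π x ≡ y) (placement w G) →
                     All (λ u → conjugate π f (u ++ w) ≡ dynamics (shape G) u ++ w) (attractor (shape G))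
  conjugate-agrees (c1 x) fx (πx ∷ []) =
    conjugate-maps π f πx fx πx ∷ []
  conjugate-agrees (c2 x y) (fx , fy) (πx ∷ πy ∷ []) =
    conjugate-maps π f πx fx πy ∷ conjugate-maps π f πy fy πx ∷ []
  conjugate-agrees (p2p2 a b c a′ b′ c′) (fa , fb , fa′ , fb′) (πa ∷ πb ∷ πc ∷ πa′ ∷ πb′ ∷ πc′ ∷ []) =
    conjugate-maps π f πb fb πc ∷ conjugate-maps π f πa fa πb ∷
    conjugate-maps π f πb′ fb′ πc′ ∷ conjugate-maps π f πa′ fa′ πb′ ∷ []

map-++-disjoint : ∀ {k m} {w w′ : Config m} {S S′ : List (Config k)} →
                  w ≢ w′ → Disjoint (map (_++ w) S) (map (_++ w′) S′)
map-++-disjoint w≢w′ (y∈ , y∈′) with ∈-map⁻ (_++ _) y∈ | ∈-map⁻ (_++ _) y∈′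
... | u , _ , refl | u′ , _ , eq = w≢w′ (++-injectiveʳ u u′ eq)

map-concat-tabulate : ∀ {a b} {A : Set a} {B : Set b} {d} (g : A → B) (P : Fin d → List A) →
                      map g (concat (List.tabulate P)) ≡ concat (List.tabulate (map g ∘ P))
map-concat-tabulate g P = begin
  map g (concat (List.tabulate P))       ≡⟨ concat-map (List.tabulate P) ⟨
  concat (map (map g) (List.tabulate P)) ≡⟨ cong concat (map-tabulate P (map g)) ⟩
  concat (List.tabulate (map g ∘ P))     ∎
  where open ≡-Reasoning

module GadgetPlacement {m} (f : Fn (3 + m)) (gs : List (Gadget (3 + m)))
              (gs-in-f : All (InS f) gs) (gs-disjoint : Unique (concatMap verts gs))
              (room : length gs ≤ 2 ^ m) where

  label : Fin (length gs) → Config m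
  label i = binary m (inject≤ i room)

  label-injective : Injective _≡_ _≡_ label
  label-injective = inject≤-injective room room _ _ ∘ binary-injective m

  block : Fin (length gs) → List (Config (3 + m) × Config (3 + m))
  block i = placement (label i) (List.lookup gs i)

  assignment : List (Config (3 + m) × Config (3 + m))
  assignment = concat (List.tabulate block)

  assignment-sources : map proj₁ assignment ≡ concatMap verts gs
  assignment-sources = begin
    map proj₁ assignment
      ≡⟨ map-concat-tabulate proj₁ block ⟩
    concat (List.tabulate (map proj₁ ∘ block))
      ≡⟨ cong concat (tabulate-cong λ i → placement-sources (label i) (List.lookup gs i)) ⟩
    concat (List.tabulate (verts ∘ List.lookup gs))
      ≡⟨ cong concat (map-tabulate (List.lookup gs) verts) ⟨
    concatMap verts (List.tabulate (List.lookup gs))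
      ≡⟨ cong (concatMap verts) (tabulate-lookup gs) ⟩
    concatMap verts gs
      ∎
    where open ≡-Reasoning

  assignment-targets-unique : Unique (map proj₂ assignment)
  assignment-targets-unique rewrite map-concat-tabulate proj₂ block =
    Unique.concat⁺ (All.tabulate⁺ block-unique) (AllPairs.tabulate⁺ blocks-disjoint)
    where
    block-unique : ∀ i → Unique (map proj₂ (block i))
    block-unique i rewrite placement-targets (label i) (List.lookup gs i) =
      Unique.map⁺ (++-injectiveˡ _ _) (slots-unique _)
    blocks-disjoint : ∀ {i j} → i ≢ j → Disjoint (map proj₂ (block i)) (map proj₂ (block j))
    blocks-disjoint {i} {j} i≢j
      rewrite placement-targets (label i) (List.lookup gs i)
            | placement-targets (label j) (List.lookup gs j) =
      map-++-disjoint (i≢j ∘ label-injective)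

  matching : Σ (Config (3 + m) ↔ Config (3 + m)) λ π → All (λ (x , y) → to π x ≡ y) assignment
  matching = matching⇒bijection (≡-dec Bool._≟_) assignment
               (subst Unique (sym assignment-sources) gs-disjoint) assignment-targets-unique

  π : Config (3 + m) ↔ Config (3 + m)
  π = proj₁ matching

  block-placed : ∀ i → All (λ (x , y) → to π x ≡ y) (block i)
  block-placed = All.tabulate⁻ (All.concat⁻ (proj₂ matching))

  h : Fn (3 + m)
  h = conjugate π f

  att : Fin (length gs) → List (Config (3 + m))
  att i = map (_++ label i) (attractor (shape (List.lookup gs i)))

  att-rootedTrap : ∀ i → RootedTrap h (att i)
  att-rootedTrap i = rootedTrap-++
    (conjugate-agrees π f (label i) (List.lookup gs i) (All.lookup gs-in-f (∈-lookup i)) (block-placed i))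
    (rootedTrap (shape (List.lookup gs i)))

  att-isAttractor : ∀ i → IsAttractor h (att i)
  att-isAttractor i = rootedTrap⇒attractor h (att-rootedTrap i)

  att-length : ∀ i → length (att i) ≤ 4
  att-length i = ≤-trans (≤-reflexive (length-map (_++ label i) (attractor s))) (attractor-length s)
    where
    s : Shape
    s = shape (List.lookup gs i)

  att-distinct : ∀ i j → i ≢ j → ¬ SameSet (att i) (att j)
  att-distinct i j i≢j (i⊆j , _) =
    map-++-disjoint (i≢j ∘ label-injective) (root∈ , i⊆j _ root∈)
    where open RootedTrap (att-rootedTrap i)

lemma16 : (n : ℕ) (f : Fn n) (gs : List (Gadget n)) →
    All (InS f) gs → Unique (concatMap verts gs) → 8 * length gs ≤ 2 ^ n →
    Σ (Fn n) λ h → (h ∼ f) ×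
      Σ (Fin (length gs) → List (Config n)) λ att →
        (∀ i → IsAttractor h (att i)) × (∀ i → length (att i) ≤ 4) ×
        (∀ i j → i ≢ j → ¬ SameSet (att i) (att j))
lemma16 (suc (suc (suc m))) f gs gs-in-f gs-disjoint 8d≤2ⁿ =
  h , conjugate-∼ π f , att , att-isAttractor , att-length , att-distinct
  where
  room : length gs ≤ 2 ^ m
  room = *-cancelˡ-≤ 8 (subst (8 * length gs ≤_) (^-distribˡ-+-* 2 3 m) 8d≤2ⁿ)
  open GadgetPlacement f gs gs-in-f gs-disjoint room
lemma16 n f [] _ _ _ = f , conjugate-∼ (↔-id _) f , (λ ()) , (λ ()) , (λ ()) , λ ()
lemma16 0 f (_ ∷ _) _ _ 8d≤2ⁿ with s≤s () ← ≤-trans (m≤m*n 8 _) 8d≤2ⁿ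
lemma16 1 f (_ ∷ _) _ _ 8d≤2ⁿ with s≤s (s≤s ()) ← ≤-trans (m≤m*n 8 _) 8d≤2ⁿ
lemma16 2 f (_ ∷ _) _ _ 8d≤2ⁿ with s≤s (s≤s (s≤s (s≤s ()))) ← ≤-trans (m≤m*n 8 _) 8d≤2ⁿ
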